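{- Let $m\ge3$ be an odd integer and let $\ell$ be a distance magic labeling of $C_{2m}\square C_{2m}$, written $\ell_{i,j}=\ell((i,j))$ with indices modulo $2m$. Then for all $i,j,s$ with $0\le i,j,s<2m$, $$\ell_{i,j}+\ell_{i-1,j+1}=(-1)^s\left(\ell_{i+s,j+s}+\ell_{i+s-1,j+s+1}\right).$$
   Context: $\mathcal{N}_N=\{1-N,3-N,\ldots,N-1\}$. A distance magic labeling of a graph of order $N$ is a bijection $\ell:V\to\mathcal{N}_N$ such that every vertex has neighbour-label sum $0$. $C_{2m}\square C_{2m}$ is the Cayley graph of $\mathbb{Z}_{2m}\times\mathbb{Z}_{2m}$ with connection set $\{\pm(1,0),\pm(0,1)\}$. -}

module Defs where

open import Data.Nat using (ℕ; suc; _+_; _*_; _∸_; NonZero)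
open import Data.Nat.DivMod using (_%_; m%n<n)
open import Data.Fin using (Fin; toℕ; fromℕ<)
open import Data.Product using (_×_; _,_)
open import Data.Integer as ℤ using (ℤ; +_)
open import Function.Bundles using (_⤖_; Bijection)
open import Relation.Binary.PropositionalEquality using (_≡_)
open import Data.Nat.Properties using (m*n≢0)

shift : (n : ℕ) → .{{_ : NonZero n}} → Fin n → ℕ → Fin n
shift n i a = fromℕ< (m%n<n (toℕ i + a) n)

-- i - 1 modulo n, written as i + (n - 1)
pred' : (n : ℕ) → .{{_ : NonZero n}} → Fin n → Fin n
pred' n i = shift n i (n ∸ 1)

Vtx : ℕ → Set
Vtx m = Fin (2 * m) × Fin (2 * m)

-- the label set N_N = {1-N, 3-N, ..., N-1}; its k-th element (k < N) is (1-N)+2k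
labelVal : (N : ℕ) → Fin N → ℤ
labelVal N k = (+ 1 ℤ.- + N) ℤ.+ + (2 * toℕ k)

-- a distance magic labeling of C_{2m} □ C_{2m} (order N = (2m)^2):
-- a bijection V → N_N (encoded as a bijection V ⤖ Fin N composed with labelVal)
-- such that at every vertex the sum of labels of the 4 neighbours
-- (i±1, j), (i, j±1) is 0.
-- Z_{2m} operations: i + a and i - 1 modulo 2m
sh : (m : ℕ) → .{{_ : NonZero m}} → Fin (2 * m) → ℕ → Fin (2 * m)
sh m i a = shift (2 * m) {{m*n≢0 2 m}} i a

pr : (m : ℕ) → .{{_ : NonZero m}} → Fin (2 * m) → Fin (2 * m)
pr m i = pred' (2 * m) {{m*n≢0 2 m}} i

record DistMagic (m : ℕ) .{{_ : NonZero m}} : Set where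
  field
    bij : Vtx m ⤖ Fin ((2 * m) * (2 * m))
  lab : Vtx m → ℤ
  lab v = labelVal ((2 * m) * (2 * m)) (Bijection.to bij v)
  field
    magic : ∀ (i j : Fin (2 * m)) →
      lab (sh m i 1 , j) ℤ.+ lab (pr m i , j)
        ℤ.+ lab (i , sh m j 1) ℤ.+ lab (i , pr m j) ≡ + 0

{-# OPTIONS --safe #-}
-- Put f(i,j) = ℓ(i,j) + ℓ(i-1,j+1). The four neighbours of (i,j+1) are
-- (i,j), (i-1,j+1), (i+1,j+1), (i,j+2), so the magic condition there says exactly
-- f(i,j) + f(i+1,j+1) = 0: along a diagonal, f changes sign at every step.
module Submission where

open import Defs
open import Data.Nat using (ℕ; zero; suc; _+_; _∸_; _*_; _≤_; NonZero; >-nonZero⁻¹)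
open import Data.Nat.DivMod using (_%_; m%n<n; %-distribˡ-+; m%n%n≡m%n; [m+n]%n≡m%n; m<n⇒m%n≡m)
open import Data.Nat.Properties using (+-assoc; +-comm; +-identityʳ; m+[n∸m]≡n; m*n≢0)
open import Data.Fin using (Fin; toℕ)
open import Data.Fin.Properties using (toℕ-fromℕ<; toℕ-injective; toℕ<n)
open import Data.Product using (_,_)
open import Data.Integer as ℤ using (ℤ; -1ℤ; -_; _^_)
open import Data.Integer.Properties using (*-identityˡ; *-assoc; neg-distribʳ-*; -1*i≡-i; +-identityˡ)
open import Data.Integer.Tactic.RingSolver using (solve-∀)
open import Relation.Binary.PropositionalEquality
open ≡-Reasoning

module _ (n : ℕ) .{{_ : NonZero n}} where

  toℕ-shift : ∀ (i : Fin n) a → toℕ (shift n i a) ≡ (toℕ i + a) % n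
  toℕ-shift i a = toℕ-fromℕ< (m%n<n (toℕ i + a) n)

  [m%n+k]%n≡[m+k]%n : ∀ x k → (x % n + k) % n ≡ (x + k) % n
  [m%n+k]%n≡[m+k]%n x k = begin
    (x % n + k) % n          ≡⟨ %-distribˡ-+ (x % n) k n ⟩
    (x % n % n + k % n) % n  ≡⟨ cong (λ y → (y + k % n) % n) (m%n%n≡m%n x n) ⟩
    (x % n + k % n) % n      ≡⟨ %-distribˡ-+ x k n ⟨
    (x + k) % n              ∎

  shift-shift : ∀ (i : Fin n) a b → shift n (shift n i a) b ≡ shift n i (a + b)
  shift-shift i a b = toℕ-injective (begin
    toℕ (shift n (shift n i a) b)  ≡⟨ toℕ-shift (shift n i a) b ⟩
    (toℕ (shift n i a) + b) % n    ≡⟨ cong (λ x → (x + b) % n) (toℕ-shift i a) ⟩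
    ((toℕ i + a) % n + b) % n      ≡⟨ [m%n+k]%n≡[m+k]%n (toℕ i + a) b ⟩
    (toℕ i + a + b) % n            ≡⟨ cong (_% n) (+-assoc (toℕ i) a b) ⟩
    (toℕ i + (a + b)) % n          ≡⟨ toℕ-shift i (a + b) ⟨
    toℕ (shift n i (a + b))        ∎)

  shift-zero : ∀ (i : Fin n) → shift n i 0 ≡ i
  shift-zero i = toℕ-injective (begin
    toℕ (shift n i 0)  ≡⟨ toℕ-shift i 0 ⟩
    (toℕ i + 0) % n    ≡⟨ cong (_% n) (+-identityʳ (toℕ i)) ⟩
    toℕ i % n          ≡⟨ m<n⇒m%n≡m (toℕ<n i) ⟩
    toℕ i              ∎)

  shift-n : ∀ (i : Fin n) → shift n i n ≡ i
  shift-n i = toℕ-injective (begin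
    toℕ (shift n i n)  ≡⟨ toℕ-shift i n ⟩
    (toℕ i + n) % n    ≡⟨ [m+n]%n≡m%n (toℕ i) n ⟩
    toℕ i % n          ≡⟨ m<n⇒m%n≡m (toℕ<n i) ⟩
    toℕ i              ∎)

  pred'-shift-1 : ∀ (i : Fin n) → pred' n (shift n i 1) ≡ i
  pred'-shift-1 i = begin
    shift n (shift n i 1) (n ∸ 1)  ≡⟨ shift-shift i 1 (n ∸ 1) ⟩
    shift n i (1 + (n ∸ 1))        ≡⟨ cong (shift n i) (m+[n∸m]≡n (>-nonZero⁻¹ n)) ⟩
    shift n i n                    ≡⟨ shift-n i ⟩
    i                              ∎

alternating-sign : (g : ℕ → ℤ) → (∀ k → g k ≡ - g (suc k)) → ∀ k → g 0 ≡ -1ℤ ^ k ℤ.* g k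
alternating-sign g flips zero = sym (*-identityˡ (g 0))
alternating-sign g flips (suc k) = begin
  g 0                                ≡⟨ alternating-sign g flips k ⟩
  -1ℤ ^ k ℤ.* g k                    ≡⟨ cong (-1ℤ ^ k ℤ.*_) (flips k) ⟩
  -1ℤ ^ k ℤ.* - g (suc k)            ≡⟨ neg-distribʳ-* (-1ℤ ^ k) (g (suc k)) ⟨
  - (-1ℤ ^ k ℤ.* g (suc k))          ≡⟨ -1*i≡-i _ ⟨
  -1ℤ ℤ.* (-1ℤ ^ k ℤ.* g (suc k))    ≡⟨ *-assoc -1ℤ (-1ℤ ^ k) (g (suc k)) ⟨
  -1ℤ ^ suc k ℤ.* g (suc k)          ∎

module _ {m : ℕ} .{{_ : NonZero m}} (ℓ : DistMagic m) where

  open DistMagic ℓ using (lab; magic)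

  private instance
    2m≢0 : NonZero (2 * m)
    2m≢0 = m*n≢0 2 m

  antidiagonalSum : Fin (2 * m) → Fin (2 * m) → ℤ
  antidiagonalSum i j = lab (i , j) ℤ.+ lab (pr m i , sh m j 1)

  antidiagonalSum-flip : ∀ i j → antidiagonalSum i j ≡ - antidiagonalSum (sh m i 1) (sh m j 1)
  antidiagonalSum-flip i j = begin
    d ℤ.+ b                  ≡⟨ rearrange a b c d ⟩
    (a ℤ.+ b ℤ.+ c ℤ.+ d) ℤ.+ - (a ℤ.+ c)
                             ≡⟨ cong (ℤ._+ - (a ℤ.+ c)) magic-at-i-j+1 ⟩
    ℤ.+ 0 ℤ.+ - (a ℤ.+ c)    ≡⟨ +-identityˡ _ ⟩
    - (a ℤ.+ c)              ≡⟨ cong (λ k → - (a ℤ.+ lab (k , sh m (sh m j 1) 1))) (pred'-shift-1 (2 * m) i) ⟨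
    - antidiagonalSum (sh m i 1) (sh m j 1) ∎
    where
    a b c d : ℤ
    a = lab (sh m i 1 , sh m j 1)
    b = lab (pr m i , sh m j 1)
    c = lab (i , sh m (sh m j 1) 1)
    d = lab (i , j)
    rearrange : ∀ a b c d → d ℤ.+ b ≡ (a ℤ.+ b ℤ.+ c ℤ.+ d) ℤ.+ - (a ℤ.+ c)
    rearrange = solve-∀
    magic-at-i-j+1 : a ℤ.+ b ℤ.+ c ℤ.+ d ≡ ℤ.+ 0
    magic-at-i-j+1 = subst (λ k → a ℤ.+ b ℤ.+ c ℤ.+ lab (i , k) ≡ ℤ.+ 0)
                       (pred'-shift-1 (2 * m) j) (magic i (sh m j 1))

  antidiagonalSum-along-diagonal : ∀ i j s →
    antidiagonalSum i j ≡ -1ℤ ^ s ℤ.* antidiagonalSum (sh m i s) (sh m j s)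
  antidiagonalSum-along-diagonal i j s = begin
    antidiagonalSum i j                    ≡⟨ cong₂ antidiagonalSum (shift-zero (2 * m) i) (shift-zero (2 * m) j) ⟨
    g 0                                    ≡⟨ alternating-sign g g-flip s ⟩
    -1ℤ ^ s ℤ.* g s                        ∎
    where
    g : ℕ → ℤ
    g k = antidiagonalSum (sh m i k) (sh m j k)
    sh-suc : ∀ x k → sh m (sh m x k) 1 ≡ sh m x (suc k)
    sh-suc x k = trans (shift-shift (2 * m) x k 1) (cong (sh m x) (+-comm k 1))
    g-flip : ∀ k → g k ≡ - g (suc k)
    g-flip k = trans (antidiagonalSum-flip (sh m i k) (sh m j k))
      (cong₂ (λ i′ j′ → - antidiagonalSum i′ j′) (sh-suc i k) (sh-suc j k))

-- The identity holds for every m > 0.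
lemma4p4 : (m : ℕ) → .{{_ : NonZero m}} → 3 ≤ m → m % 2 ≡ 1 → (ℓ : DistMagic m) →
    let L = DistMagic.lab ℓ
        n = 2 * m
        sg = λ (s : ℕ) (x : ℤ) → ℤ.-1ℤ ℤ.^ s ℤ.* x
    in ∀ (i j s : Fin n) →
      L (i , j) ℤ.+ L (pr m i , sh m j 1)
        ≡ sg (toℕ s) (L (sh m i (toℕ s) , sh m j (toℕ s))
            ℤ.+ L (pr m (sh m i (toℕ s)) , sh m (sh m j (toℕ s)) 1))
lemma4p4 m _ _ ℓ i j s = antidiagonalSum-along-diagonal ℓ i j (toℕ s)
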